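{- For integers $d>m\ge 1$, $f_{\triangle}(d,m)=dm$.
   Context: All graphs are finite, simple and undirected. A graph is triangle-free if it has no three pairwise adjacent vertices. $\Delta(G)$ is the maximum degree and $\nu(G)$ the matching number of $G$. For positive integers $d,m$, $f_{\triangle}(d,m)$ is the maximum number of edges of a triangle-free graph $G$ with $\Delta(G)\le d$ and $\nu(G)\le m$. -}

module Defs where

open import Data.Nat using (ℕ; zero; suc; _+_; _≤_; _<ᵇ_)
open import Data.Bool using (Bool; true; false; if_then_else_; _∧_)
open import Data.Fin using (Fin; toℕ)
open import Data.List using (List; []; _∷_; length; map; allFin; concatMap)
open import Data.Nat.ListAction using (sum)
open import Data.List.Relation.Unary.All using (All)
open import Data.List.Relation.Unary.Unique.Propositional using (Unique)
open import Data.Product using (_×_; _,_; Σ; ∃-syntax)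
open import Relation.Binary.PropositionalEquality using (_≡_)
open import Relation.Nullary using (¬_)

record Graph : Set where
  field
    n     : ℕ
    adj   : Fin n → Fin n → Bool
    sym   : ∀ i j → adj i j ≡ adj j i
    irrefl : ∀ i → adj i i ≡ false
open Graph public

bit : Bool → ℕ
bit true  = 1
bit false = 0

degree : (G : Graph) → Fin (n G) → ℕ
degree G v = sum (map (λ w → bit (adj G v w)) (allFin (n G)))

-- number of edges: unordered pairs {i,j} (counted once via toℕ i < toℕ j)
numEdges : Graph → ℕ
numEdges G = sum (map (λ i → sum (map (λ j → bit ((toℕ i <ᵇ toℕ j) ∧ adj G i j))
                                      (allFin (n G))))
                      (allFin (n G)))

MaxDegreeAtMost : Graph → ℕ → Set
MaxDegreeAtMost G d = ∀ v → degree G v ≤ d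

-- a matching: a list of edges whose endpoints are pairwise distinct
-- (so the edges are distinct and pairwise vertex-disjoint)
endpoints : ∀ {k} → List (Fin k × Fin k) → List (Fin k)
endpoints = concatMap (λ { (a , b) → a ∷ b ∷ [] })

IsMatching : (G : Graph) → List (Fin (n G) × Fin (n G)) → Set
IsMatching G M = All (λ { (a , b) → adj G a b ≡ true }) M × Unique (endpoints M)

MatchingNumberAtMost : Graph → ℕ → Set
MatchingNumberAtMost G m = ∀ M → IsMatching G M → length M ≤ m

TriangleFree : Graph → Set
TriangleFree G = ¬ (∃[ a ] ∃[ b ] ∃[ c ]
  (adj G a b ≡ true × adj G b c ≡ true × adj G a c ≡ true))

Admissible : ℕ → ℕ → Graph → Set
Admissible d m G = TriangleFree G × MaxDegreeAtMost G d × MatchingNumberAtMost G m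

-- "f_△(d,m) = k": k is the maximum number of edges of an admissible graph
-- (attained, and an upper bound)
IsFTriangle : ℕ → ℕ → ℕ → Set
IsFTriangle d m k =
  (Σ Graph λ G → Admissible d m G × numEdges G ≡ k)
  × (∀ G → Admissible d m G → numEdges G ≤ k)

module Submission where

-- The complete bipartite graph K_{m,d} is triangle-free, has maximum degree d, has dm edges,
-- and its m-vertex side covers every edge, so its matching number is m.
--
-- For the upper bound e(G) ≤ dk (triangle-free, Δ(G) ≤ d, ν(G) ≤ k < d) induct on the number
-- of vertices. If some vertex v has degree > k, then ν(G − v) < k: a matching of G − v with k
-- edges cannot be extended at v, so it covers every neighbour of v, and since the neighbourhood
-- of v is independent each of its edges contains at most one neighbour, forcing deg v ≤ k.
-- Hence e(G) = deg v + e(G − v) ≤ d + d(k − 1). Otherwise every degree is at most k; deleting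
-- both ends of an edge removes at most 2k − 1 edges and lowers the matching number, so the
-- induction hypothesis with k in the role of d gives e(G) ≤ 2k − 1 + k(k − 1) < dk.

open import Defs hiding (sym)
open import Data.Bool as Bool using (Bool; true; false; _∧_; _∨_; _xor_)
open import Data.Bool.Properties using (¬-not; xor-comm; xor-same; ∧-zeroʳ)
open import Data.Empty using (⊥; ⊥-elim)
open import Data.Fin as Fin using (Fin; zero; suc; toℕ; punchIn; punchOut; _↑ˡ_; _↑ʳ_; splitAt)
open import Data.Fin.Properties
  using (toℕ-injective; punchIn-injective; punchInᵢ≢i; punchIn-punchOut; splitAt-↑ˡ; splitAt-↑ʳ; any?)
open import Data.List using (List; []; _∷_; length; map; allFin; tabulate)
open import Data.List.Properties using (map-tabulate; length-map)
open import Data.List.Membership.Propositional using (_∈_; _∉_)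
open import Data.List.Membership.Propositional.Properties using (∈-map⁻; ∈-allFin)
open import Data.List.Relation.Unary.All using ([]; _∷_; lookup)
import Data.List.Relation.Unary.All.Properties as All
open import Data.List.Relation.Unary.All.Properties using (¬Any⇒All¬)
open import Data.List.Relation.Unary.AllPairs using ([]; _∷_)
import Data.List.Relation.Unary.Any as Any
open import Data.List.Relation.Unary.Any using (here; there)
open import Data.List.Relation.Unary.Unique.Propositional using (Unique)
import Data.List.Relation.Unary.Unique.Propositional.Properties as Unique
open import Data.Nat using (ℕ; zero; suc; pred; _+_; _*_; _≤_; _<_; _<ᵇ_; z≤n; s≤s)
open import Data.Nat.Induction using (<-wellFounded)
open import Data.Nat.ListAction using (sum)
open import Data.Nat.Properties hiding (_≟_)
open import Data.Nat.Tactic.RingSolver using (solve-∀)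
open import Algebra.Properties.CommutativeSemigroup +-commutativeSemigroup using (x∙yz≈y∙xz)
open import Algebra.Properties.CommutativeMonoid.Sum +-0-commutativeMonoid
  using (sum-syntax; sum-cong-≗; sum-remove; sum-replicate-zero; ∑-distrib-+; ∑-comm)
open import Data.Product using (_×_; _,_; ∃; proj₂)
import Data.Product as Prod
open import Data.Sum using (_⊎_; inj₁; inj₂; [_,_]′)
open import Function using (_∘_; const)
import Induction.WellFounded as WF
open import Level using (0ℓ)
import Relation.Binary.Construct.On as On
open import Relation.Binary.Definitions using (tri<; tri≈; tri>)
open import Relation.Binary.PropositionalEquality
open import Relation.Nullary using (yes; no; contradiction)

∑-const : ∀ k c → ∑[ i < k ] c ≡ k * c
∑-const zero    c = refl
∑-const (suc k) c = cong (c +_) (∑-const k c)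

∑-↑ : ∀ k l (f : Fin (k + l) → ℕ) →
      ∑[ i < k + l ] f i ≡ ∑[ i < k ] f (i ↑ˡ l) + ∑[ j < l ] f (k ↑ʳ j)
∑-↑ zero    l f = refl
∑-↑ (suc k) l f = trans (cong (f zero +_) (∑-↑ k l (f ∘ suc))) (sym (+-assoc (f zero) _ _))

sum-tabulate : ∀ {k} (f : Fin k → ℕ) → sum (tabulate f) ≡ ∑[ i < k ] f i
sum-tabulate {zero}  f = refl
sum-tabulate {suc k} f = cong (f zero +_) (sum-tabulate (f ∘ suc))

sum-map-allFin : ∀ k (f : Fin k → ℕ) → sum (map f (allFin k)) ≡ ∑[ i < k ] f i
sum-map-allFin k f = trans (cong sum (map-tabulate (λ i → i) f)) (sum-tabulate f)

module _ {A : Set} (f : A → ℕ) where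

  sum-map-∈ : ∀ {x xs} → x ∈ xs →
              ∃ λ ys → sum (map f xs) ≡ f x + sum (map f ys) × (∀ {y} → y ∈ xs → y ≢ x → y ∈ ys)
  sum-map-∈ {xs = _ ∷ xs} (here refl) =
    xs , refl , λ { (here refl) y≢x → contradiction refl y≢x ; (there y∈xs) _ → y∈xs }
  sum-map-∈ {x} {z ∷ xs} (there x∈xs) with ys , eq , keep ← sum-map-∈ x∈xs =
    z ∷ ys , trans (cong (f z +_) eq) (x∙yz≈y∙xz (f z) (f x) (sum (map f ys))) ,
    λ { (here refl) _ → here refl ; (there y∈xs) y≢x → there (keep y∈xs y≢x) }

  sum-map-≤-support⊆ : ∀ {xs ys} → Unique xs → (∀ {x} → x ∈ xs → f x ≡ 0 ⊎ x ∈ ys) →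
                       sum (map f xs) ≤ sum (map f ys)
  sum-map-≤-support⊆ {[]}     _               _       = z≤n
  sum-map-≤-support⊆ {x ∷ xs} (x∉xs ∷ unique) support with support (here refl)
  ... | inj₁ fx≡0 rewrite fx≡0 = sum-map-≤-support⊆ unique (λ y∈xs → support (there y∈xs))
  ... | inj₂ x∈ys with ys′ , eq , keep ← sum-map-∈ x∈ys rewrite eq =
    +-monoʳ-≤ (f x) (sum-map-≤-support⊆ unique support′)
    where
    support′ : ∀ {y} → y ∈ xs → f y ≡ 0 ⊎ y ∈ ys′
    support′ y∈xs with support (there y∈xs)
    ... | inj₁ fy≡0 = inj₁ fy≡0
    ... | inj₂ y∈ys = inj₂ (keep y∈ys (≢-sym (lookup x∉xs y∈xs)))

-- punchIn, typed so that it applies to Fin (n G) without knowing that n G is a successor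
skip : ∀ {k} → Fin k → Fin (pred k) → Fin k
skip {suc k} = punchIn

skip-injective : ∀ {k} (v : Fin k) {x y} → skip v x ≡ skip v y → x ≡ y
skip-injective {suc k} v = punchIn-injective v _ _

skip≢ : ∀ {k} (v : Fin k) x → skip v x ≢ v
skip≢ {suc k} v x = punchInᵢ≢i v x

skip-surjective : ∀ {k} {v w : Fin k} → v ≢ w → ∃ λ x → skip v x ≡ w
skip-surjective {suc k} v≢w = punchOut v≢w , punchIn-punchOut v≢w

pred< : ∀ {k} → Fin k → pred k < k
pred< {suc k} _ = n<1+n k

∑-skip : ∀ {k} (v : Fin k) (f : Fin k → ℕ) →
         ∑[ i < k ] f i ≡ f v + ∑[ j < pred k ] f (skip v j)
∑-skip {suc k} v f = sum-remove {i = v} f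

degreeSum : Graph → ℕ
degreeSum G = ∑[ v < n G ] degree G v

degree-∑ : ∀ G v → degree G v ≡ ∑[ w < n G ] bit (adj G v w)
degree-∑ G v = sum-map-allFin (n G) _

<ᵇ-true : ∀ {i j} → i < j → (i <ᵇ j) ≡ true
<ᵇ-true {zero}  {suc j} _         = refl
<ᵇ-true {suc i} {suc j} (s≤s i<j) = <ᵇ-true i<j

<ᵇ-false : ∀ {i j} → j ≤ i → (i <ᵇ j) ≡ false
<ᵇ-false {i}     {zero}  _         = refl
<ᵇ-false {suc i} {suc j} (s≤s j≤i) = <ᵇ-false j≤i

orientedEdge : (G : Graph) → Fin (n G) → Fin (n G) → ℕ
orientedEdge G i j = bit ((toℕ i <ᵇ toℕ j) ∧ adj G i j)

orientedEdge-+-flip : ∀ G i j → orientedEdge G i j + orientedEdge G j i ≡ bit (adj G i j)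
orientedEdge-+-flip G i j with <-cmp (toℕ i) (toℕ j)
... | tri< i<j _ _ rewrite <ᵇ-true i<j | <ᵇ-false (<⇒≤ i<j) = +-identityʳ _
... | tri> _ _ j<i rewrite <ᵇ-true j<i | <ᵇ-false (<⇒≤ j<i) = cong bit (Graph.sym G j i)
... | tri≈ _ i≡j _ with refl ← toℕ-injective i≡j
  rewrite <ᵇ-false (≤-refl {toℕ i}) | irrefl G i = refl

numEdges-∑ : ∀ G → numEdges G ≡ ∑[ i < n G ] ∑[ j < n G ] orientedEdge G i j
numEdges-∑ G = trans (sum-map-allFin (n G) (λ i → sum (map (orientedEdge G i) (allFin (n G)))))
                     (sum-cong-≗ (λ i → sum-map-allFin (n G) (orientedEdge G i)))

handshake : ∀ G → degreeSum G ≡ 2 * numEdges G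
handshake G = begin
  degreeSum G                                   ≡⟨ sum-cong-≗ (degree-∑ G) ⟩
  ∑[ i < N ] ∑[ j < N ] bit (adj G i j)         ≡⟨ sum-cong-≗ (λ i → sum-cong-≗ (orientedEdge-+-flip G i)) ⟨
  ∑[ i < N ] ∑[ j < N ] (o i j + o j i)         ≡⟨ sum-cong-≗ (λ i → ∑-distrib-+ (o i) (λ j → o j i)) ⟩
  ∑[ i < N ] (∑[ j < N ] o i j + ∑[ j < N ] o j i)
                                                ≡⟨ ∑-distrib-+ (λ i → ∑[ j < N ] o i j) _ ⟩
  E + ∑[ i < N ] ∑[ j < N ] o j i               ≡⟨ cong (E +_) (∑-comm (λ i j → o j i)) ⟩
  E + E                                         ≡⟨ cong (E +_) (+-identityʳ E) ⟨
  2 * E                                         ≡⟨ cong (2 *_) (numEdges-∑ G) ⟨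
  2 * numEdges G                                ∎
  where
  open ≡-Reasoning
  N = n G
  o = orientedEdge G
  E = ∑[ i < N ] ∑[ j < N ] o i j

_─_ : (G : Graph) → Fin (n G) → Graph
G ─ v = record
  { n      = pred (n G)
  ; adj    = λ x y → adj G (skip v x) (skip v y)
  ; sym    = λ x y → Graph.sym G (skip v x) (skip v y)
  ; irrefl = λ x → irrefl G (skip v x)
  }

degree-skip : ∀ G v u → degree G (skip v u) ≡ bit (adj G (skip v u) v) + degree (G ─ v) u
degree-skip G v u = begin
  degree G (skip v u)                                   ≡⟨ degree-∑ G _ ⟩
  ∑[ w < n G ] bit (adj G (skip v u) w)                 ≡⟨ ∑-skip v _ ⟩
  e + ∑[ x < pred (n G) ] bit (adj (G ─ v) u x)         ≡⟨ cong (e +_) (degree-∑ (G ─ v) u) ⟨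
  e + degree (G ─ v) u                                  ∎
  where
  open ≡-Reasoning
  e = bit (adj G (skip v u) v)

degree-─-≤ : ∀ G v u → degree (G ─ v) u ≤ degree G (skip v u)
degree-─-≤ G v u = subst (degree (G ─ v) u ≤_) (sym (degree-skip G v u)) (m≤n+m _ _)

degree-∑-skip : ∀ G v → degree G v ≡ ∑[ u < pred (n G) ] bit (adj G (skip v u) v)
degree-∑-skip G v = begin
  degree G v                              ≡⟨ degree-∑ G v ⟩
  ∑[ w < n G ] bit (adj G v w)            ≡⟨ ∑-skip v _ ⟩
  bit (adj G v v) + ∑[ u < p ] bit (adj G v (skip v u))
                                          ≡⟨ cong (λ b → bit b + ∑[ u < p ] bit (adj G v (skip v u))) (irrefl G v) ⟩
  ∑[ u < p ] bit (adj G v (skip v u))     ≡⟨ sum-cong-≗ (λ u → cong bit (Graph.sym G v (skip v u))) ⟩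
  ∑[ u < p ] bit (adj G (skip v u) v)     ∎
  where
  open ≡-Reasoning
  p = pred (n G)

degreeSum-─ : ∀ G v → degreeSum G ≡ degree G v + (degree G v + degreeSum (G ─ v))
degreeSum-─ G v = begin
  degreeSum G                                  ≡⟨ ∑-skip v (degree G) ⟩
  δ + ∑[ u < p ] degree G (skip v u)           ≡⟨ cong (δ +_) (sum-cong-≗ (degree-skip G v)) ⟩
  δ + ∑[ u < p ] (towardV u + degree G′ u)     ≡⟨ cong (δ +_) (∑-distrib-+ towardV (degree G′)) ⟩
  δ + (∑[ u < p ] towardV u + degreeSum G′)    ≡⟨ cong (λ t → δ + (t + degreeSum G′)) (degree-∑-skip G v) ⟨
  δ + (δ + degreeSum G′)                       ∎
  where
  open ≡-Reasoning
  p = pred (n G)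
  δ = degree G v
  G′ = G ─ v
  towardV : Fin p → ℕ
  towardV u = bit (adj G (skip v u) v)

numEdges-─ : ∀ G v → numEdges G ≡ degree G v + numEdges (G ─ v)
numEdges-─ G v = *-cancelˡ-≡ _ _ 2 (begin
  2 * numEdges G                     ≡⟨ handshake G ⟨
  degreeSum G                        ≡⟨ degreeSum-─ G v ⟩
  δ + (δ + degreeSum (G ─ v))        ≡⟨ cong (λ t → δ + (δ + t)) (handshake (G ─ v)) ⟩
  δ + (δ + 2 * numEdges (G ─ v))     ≡⟨ double-+ δ (numEdges (G ─ v)) ⟩
  2 * (δ + numEdges (G ─ v))         ∎)
  where
  open ≡-Reasoning
  δ = degree G v
  double-+ : ∀ a b → a + (a + 2 * b) ≡ 2 * (a + b)
  double-+ = solve-∀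

adj⇒≢ : ∀ G {a b} → adj G a b ≡ true → a ≢ b
adj⇒≢ G {a} ab refl = contradiction (trans (sym ab) (irrefl G a)) λ ()

extend : ∀ {G M a b} → IsMatching G M → adj G a b ≡ true →
         a ∉ endpoints M → b ∉ endpoints M → IsMatching G ((a , b) ∷ M)
extend {G} (edges , unique) ab a∉ b∉ =
  ab ∷ edges , (adj⇒≢ G ab ∷ ¬Any⇒All¬ _ a∉) ∷ ¬Any⇒All¬ _ b∉ ∷ unique

edge-isMatching : ∀ G {a b} → adj G a b ≡ true → IsMatching G ((a , b) ∷ [])
edge-isMatching G ab = extend {G} ([] , []) ab (λ ()) (λ ())

module _ (G : Graph) (f : Fin (n G) → ℕ) where

  sum-endpoints-≤-length : (∀ {a b} → adj G a b ≡ true → f a + f b ≤ 1) →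
                           ∀ {M} → IsMatching G M → sum (map f (endpoints M)) ≤ length M
  sum-endpoints-≤-length _ {[]} _ = z≤n
  sum-endpoints-≤-length edge≤1 {(a , b) ∷ M} (ab ∷ edges , _ ∷ _ ∷ unique) = begin
    f a + (f b + sum (map f (endpoints M))) ≡⟨ +-assoc (f a) (f b) _ ⟨
    (f a + f b) + sum (map f (endpoints M)) ≤⟨ +-mono-≤ (edge≤1 ab) (sum-endpoints-≤-length edge≤1 tail) ⟩
    1 + length M                            ∎
    where
    open ≤-Reasoning
    tail : IsMatching G M
    tail = edges , unique

  length-≤-sum-endpoints : (∀ {a b} → adj G a b ≡ true → 1 ≤ f a + f b) →
                           ∀ {M} → IsMatching G M → length M ≤ sum (map f (endpoints M))
  length-≤-sum-endpoints _ {[]} _ = z≤n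
  length-≤-sum-endpoints edge≥1 {(a , b) ∷ M} (ab ∷ edges , _ ∷ _ ∷ unique) = begin
    1 + length M                            ≤⟨ +-mono-≤ (edge≥1 ab) (length-≤-sum-endpoints edge≥1 tail) ⟩
    (f a + f b) + sum (map f (endpoints M)) ≡⟨ +-assoc (f a) (f b) _ ⟩
    f a + (f b + sum (map f (endpoints M))) ∎
    where
    open ≤-Reasoning
    tail : IsMatching G M
    tail = edges , unique

∨⇒1≤bit-+ : ∀ x {y} → x ∨ y ≡ true → 1 ≤ bit x + bit y
∨⇒1≤bit-+ true  _    = s≤s z≤n
∨⇒1≤bit-+ false refl = s≤s z≤n

matchingNumber-≤-cover : ∀ G (c : Fin (n G) → Bool) → (∀ {a b} → adj G a b ≡ true → c a ∨ c b ≡ true) →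
                         MatchingNumberAtMost G (∑[ w < n G ] bit (c w))
matchingNumber-≤-cover G c covers M matching = begin
  length M                            ≤⟨ length-≤-sum-endpoints G (bit ∘ c) covered-once matching ⟩
  sum (map (bit ∘ c) (endpoints M))   ≤⟨ sum-map-≤-support⊆ (bit ∘ c) (proj₂ matching) (λ {w} _ → inj₂ (∈-allFin w)) ⟩
  sum (map (bit ∘ c) (allFin (n G)))  ≡⟨ sum-map-allFin (n G) (bit ∘ c) ⟩
  ∑[ w < n G ] bit (c w)              ∎
  where
  open ≤-Reasoning
  covered-once : ∀ {a b} → adj G a b ≡ true → 1 ≤ bit (c a) + bit (c b)
  covered-once {a} ab = ∨⇒1≤bit-+ (c a) (covers ab)

neighbours-bit-+-≤1 : ∀ G {v a b} → TriangleFree G → adj G a b ≡ true →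
                      bit (adj G v a) + bit (adj G v b) ≤ 1
neighbours-bit-+-≤1 G {v} {a} {b} tf ab with adj G v a in va | adj G v b in vb
... | true  | true  = ⊥-elim (tf (v , a , b , va , ab , vb))
... | true  | false = ≤-refl
... | false | true  = ≤-refl
... | false | false = z≤n

degree-≤-length : ∀ G {v M} → TriangleFree G → IsMatching G M →
                  (∀ {w} → adj G v w ≡ true → w ∈ endpoints M) → degree G v ≤ length M
degree-≤-length G {v} {M} tf matching covered = begin
  degree G v                 ≤⟨ sum-map-≤-support⊆ f (Unique.allFin⁺ (n G)) support ⟩
  sum (map f (endpoints M))  ≤⟨ sum-endpoints-≤-length G f (neighbours-bit-+-≤1 G tf) matching ⟩
  length M                   ∎
  where
  open ≤-Reasoning
  f : Fin (n G) → ℕ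
  f w = bit (adj G v w)
  support : ∀ {w} → w ∈ allFin (n G) → f w ≡ 0 ⊎ w ∈ endpoints M
  support {w} _ with adj G v w in vw
  ... | false = inj₁ refl
  ... | true  = inj₂ (covered vw)

skipAll : ∀ {k} → Fin k → List (Fin (pred k) × Fin (pred k)) → List (Fin k × Fin k)
skipAll v = map (Prod.map (skip v) (skip v))

endpoints-skipAll : ∀ {k} (v : Fin k) M → endpoints (skipAll v M) ≡ map (skip v) (endpoints M)
endpoints-skipAll v []            = refl
endpoints-skipAll v ((x , y) ∷ M) = cong (λ e → skip v x ∷ skip v y ∷ e) (endpoints-skipAll v M)

skipAll-isMatching : ∀ G v {M} → IsMatching (G ─ v) M → IsMatching G (skipAll v M)
skipAll-isMatching G v {M} (edges , unique) =
  All.map⁺ edges ,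
  subst Unique (sym (endpoints-skipAll v M)) (Unique.map⁺ (skip-injective v) unique)

∉-endpoints-skipAll : ∀ {k} (v : Fin k) M → v ∉ endpoints (skipAll v M)
∉-endpoints-skipAll v M v∈
  with x , _ , v≡ ← ∈-map⁻ (skip v) (subst (v ∈_) (endpoints-skipAll v M) v∈) = skip≢ v x (sym v≡)

skip-∉-endpoints-skipAll : ∀ {k} (v : Fin k) {x} M →
                           x ∉ endpoints M → skip v x ∉ endpoints (skipAll v M)
skip-∉-endpoints-skipAll v {x} M x∉ sx∈
  with y , y∈ , sx≡sy ← ∈-map⁻ (skip v) (subst (skip v x ∈_) (endpoints-skipAll v M) sx∈) =
  x∉ (subst (_∈ endpoints M) (sym (skip-injective v sx≡sy)) y∈)

extendable-length-≤ : ∀ G {k v w M} → MatchingNumberAtMost G (suc k) → IsMatching (G ─ v) M →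
                      adj G v w ≡ true → w ∉ endpoints (skipAll v M) → length M ≤ k
extendable-length-≤ G {k} {v} {w} {M} ν matching vw w∉ = ≤-pred (begin
  suc (length M)                  ≡⟨ cong suc (length-map (Prod.map (skip v) (skip v)) M) ⟨
  length ((v , w) ∷ skipAll v M)  ≤⟨ ν _ (extend {G} matching⁺ vw (∉-endpoints-skipAll v M) w∉) ⟩
  suc k                           ∎)
  where
  open ≤-Reasoning
  matching⁺ = skipAll-isMatching G v matching

matchingNumber-─-highDegree : ∀ G {k v} → TriangleFree G → MatchingNumberAtMost G (suc k) →
                              suc k < degree G v → MatchingNumberAtMost (G ─ v) k
matchingNumber-─-highDegree G {k} {v} tf ν high M matching with length M ≤? k
... | yes short = short
... | no long   = ⊥-elim (<⇒≱ high degree≤)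
  where
  matching⁺ = skipAll-isMatching G v matching
  covered : ∀ {w} → adj G v w ≡ true → w ∈ endpoints (skipAll v M)
  covered {w} vw with Any.any? (w Fin.≟_) (endpoints (skipAll v M))
  ... | yes w∈ = w∈
  ... | no  w∉ = contradiction (extendable-length-≤ G ν matching vw w∉) long
  degree≤ : degree G v ≤ suc k
  degree≤ = ≤-trans (degree-≤-length G tf matching⁺ covered) (ν _ matching⁺)

matchingNumber-─-edge : ∀ G {k i j} → MatchingNumberAtMost G (suc k) → adj G i (skip i j) ≡ true →
                        MatchingNumberAtMost ((G ─ i) ─ j) k
matchingNumber-─-edge G {k} {i} {j} ν ij M matching =
  subst (_≤ k) (length-map (Prod.map (skip j) (skip j)) M)
    (extendable-length-≤ G ν (skipAll-isMatching (G ─ i) j matching) ij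
      (skip-∉-endpoints-skipAll i (skipAll j M) (∉-endpoints-skipAll j M)))

EdgeBound : Graph → Set
EdgeBound G = ∀ d k → TriangleFree G → MaxDegreeAtMost G d → MatchingNumberAtMost G k → k < d →
              numEdges G ≤ d * k

triangleFree-─ : ∀ G v → TriangleFree G → TriangleFree (G ─ v)
triangleFree-─ G v tf (x , y , z , xy , yz , xz) = tf (skip v x , skip v y , skip v z , xy , yz , xz)

maxDegree-─ : ∀ G v {d} → MaxDegreeAtMost G d → MaxDegreeAtMost (G ─ v) d
maxDegree-─ G v Δ u = ≤-trans (degree-─-≤ G v u) (Δ (skip v u))

numEdges-edgeless : ∀ G → (∀ i j → adj G i j ≡ false) → numEdges G ≡ 0
numEdges-edgeless G edgeless = begin
  numEdges G                                    ≡⟨ numEdges-∑ G ⟩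
  ∑[ i < n G ] ∑[ j < n G ] orientedEdge G i j  ≡⟨ sum-cong-≗ {n G} (sum-cong-≗ {n G} ∘ no-orientedEdge) ⟩
  ∑[ i < n G ] ∑[ j < n G ] 0                   ≡⟨ sum-cong-≗ {n G} (λ _ → sum-replicate-zero (n G)) ⟩
  ∑[ i < n G ] 0                                ≡⟨ sum-replicate-zero (n G) ⟩
  0                                             ∎
  where
  open ≡-Reasoning
  no-orientedEdge : ∀ i j → orientedEdge G i j ≡ 0
  no-orientedEdge i j = cong bit (trans (cong ((toℕ i <ᵇ toℕ j) ∧_) (edgeless i j)) (∧-zeroʳ _))

numEdges-≤-highDegree : ∀ G {d k v} → EdgeBound (G ─ v) → TriangleFree G → MaxDegreeAtMost G d →
                        MatchingNumberAtMost G (suc k) → suc k < d → suc k < degree G v →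
                        numEdges G ≤ d * suc k
numEdges-≤-highDegree G {d} {k} {v} bound tf Δ ν k<d high = begin
  numEdges G                     ≡⟨ numEdges-─ G v ⟩
  degree G v + numEdges (G ─ v)  ≤⟨ +-mono-≤ (Δ v) bound′ ⟩
  d + d * k                      ≡⟨ *-suc d k ⟨
  d * suc k                      ∎
  where
  open ≤-Reasoning
  bound′ : numEdges (G ─ v) ≤ d * k
  bound′ = bound d k (triangleFree-─ G v tf) (maxDegree-─ G v Δ)
                 (matchingNumber-─-highDegree G tf ν high) (<-trans (n<1+n k) k<d)

numEdges-≤-edge : ∀ G {d k i j} → EdgeBound ((G ─ i) ─ j) → TriangleFree G →
                  MaxDegreeAtMost G (suc k) → MatchingNumberAtMost G (suc k) → suc k < d →
                  adj G i (skip i j) ≡ true → numEdges G ≤ d * suc k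
numEdges-≤-edge G {d} {k} {i} {j} bound tf Δ ν k<d ij = begin
  numEdges G                                                ≡⟨ numEdges-─ G i ⟩
  degree G i + numEdges (G ─ i)                             ≡⟨ cong (degree G i +_) (numEdges-─ (G ─ i) j) ⟩
  degree G i + (degree (G ─ i) j + numEdges ((G ─ i) ─ j))  ≤⟨ +-mono-≤ (Δ i) (+-mono-≤ degree-j bound′) ⟩
  suc k + (k + suc k * k)                                   ≤⟨ +-monoʳ-≤ (suc k) (+-monoˡ-≤ _ (n≤1+n k)) ⟩
  suc k + (suc k + suc k * k)                               ≡⟨ cong (suc k +_) (*-suc (suc k) k) ⟨
  suc (suc k) * suc k                                       ≤⟨ *-monoˡ-≤ (suc k) k<d ⟩
  d * suc k                                                 ∎
  where
  open ≤-Reasoning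
  degree-j : degree (G ─ i) j ≤ k
  degree-j = ≤-pred (subst (_≤ suc k)
    (trans (degree-skip G i j) (cong (λ b → bit b + degree (G ─ i) j) (trans (Graph.sym G _ i) ij)))
    (Δ (skip i j)))
  bound′ : numEdges ((G ─ i) ─ j) ≤ suc k * k
  bound′ = bound (suc k) k (triangleFree-─ (G ─ i) j (triangleFree-─ G i tf))
                 (maxDegree-─ (G ─ i) j (maxDegree-─ G i Δ)) (matchingNumber-─-edge G ν ij) ≤-refl

numEdges-≤ : ∀ G → EdgeBound G
numEdges-≤ = WF.All.wfRec (On.wellFounded n <-wellFounded) 0ℓ EdgeBound step
  where
  step : ∀ G → (∀ {H} → n H < n G → EdgeBound H) → EdgeBound G
  step G rec d k tf Δ ν k<d with any? (λ i → any? (λ j → adj G i j Bool.≟ true))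
  ... | no edgeless =
    subst (_≤ d * k) (sym (numEdges-edgeless G λ i j → ¬-not λ ij → edgeless (i , j , ij))) z≤n
  ... | yes (i , j , ij) with k | skip-surjective (adj⇒≢ G ij)
  ...   | zero  | _        = contradiction (ν _ (edge-isMatching G ij)) λ ()
  ...   | suc k | j′ , refl with any? (λ v → suc k <? degree G v)
  ...     | yes (v , high) = numEdges-≤-highDegree G (rec {G ─ v} (pred< v)) tf Δ ν k<d high
  ...     | no  noneHigh   = numEdges-≤-edge G (rec {(G ─ i) ─ j′} smaller) tf Δ′ ν k<d ij
    where
    smaller : pred (pred (n G)) < n G
    smaller = <-trans (pred< j′) (pred< i)
    Δ′ : MaxDegreeAtMost G (suc k)
    Δ′ v = ≮⇒≥ λ high → noneHigh (v , high)

module CompleteBipartite (m l : ℕ) where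

  left : Fin (m + l) → Bool
  left w = [ const true , const false ]′ (splitAt m w)

  graph : Graph
  graph = record
    { n      = m + l
    ; adj    = λ x y → left x xor left y
    ; sym    = λ x y → xor-comm (left x) (left y)
    ; irrefl = λ x → xor-same (left x)
    }

  ∑-sides : (f : Bool → ℕ) → ∑[ w < m + l ] f (left w) ≡ m * f true + l * f false
  ∑-sides f = begin
    ∑[ w < m + l ] f (left w)                                        ≡⟨ ∑-↑ m l (f ∘ left) ⟩
    ∑[ a < m ] f (left (a ↑ˡ l)) + ∑[ b < l ] f (left (m ↑ʳ b))      ≡⟨ cong₂ _+_
         (sum-cong-≗ λ a → cong (f ∘ [ const true , const false ]′) (splitAt-↑ˡ m a l))
         (sum-cong-≗ λ b → cong (f ∘ [ const true , const false ]′) (splitAt-↑ʳ m l b)) ⟩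
    ∑[ a < m ] f true + ∑[ b < l ] f false                           ≡⟨ cong₂ _+_ (∑-const m _) (∑-const l _) ⟩
    m * f true + l * f false                                         ∎
    where open ≡-Reasoning

  sideDegree : Bool → ℕ
  sideDegree true  = l
  sideDegree false = m

  degree-graph : ∀ x → degree graph x ≡ sideDegree (left x)
  degree-graph x =
    trans (degree-∑ graph x) (trans (∑-sides (λ s → bit (left x xor s))) (count (left x)))
    where
    count : ∀ s → m * bit (s xor true) + l * bit (s xor false) ≡ sideDegree s
    count true  = cong₂ _+_ (*-zeroʳ m) (*-identityʳ l)
    count false = trans (cong₂ _+_ (*-identityʳ m) (*-zeroʳ l)) (+-identityʳ m)

  maxDegree : m ≤ l → MaxDegreeAtMost graph l
  maxDegree m≤l x = subst (_≤ l) (sym (degree-graph x)) (sideDegree≤ (left x))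
    where
    sideDegree≤ : ∀ s → sideDegree s ≤ l
    sideDegree≤ true  = ≤-refl
    sideDegree≤ false = m≤l

  numEdges-graph : numEdges graph ≡ l * m
  numEdges-graph = *-cancelˡ-≡ _ _ 2 (begin
    2 * numEdges graph                  ≡⟨ handshake graph ⟨
    degreeSum graph                     ≡⟨ sum-cong-≗ degree-graph ⟩
    ∑[ w < m + l ] sideDegree (left w)  ≡⟨ ∑-sides sideDegree ⟩
    m * l + l * m                       ≡⟨ mirror m l ⟩
    2 * (l * m)                         ∎)
    where
    open ≡-Reasoning
    mirror : ∀ a b → a * b + b * a ≡ 2 * (b * a)
    mirror = solve-∀

  triangleFree : TriangleFree graph
  triangleFree (x , y , z , xy , yz , xz) = xor-odd-cycle (left x) (left y) (left z) xy yz xz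
    where
    xor-odd-cycle : ∀ a b c → a xor b ≡ true → b xor c ≡ true → a xor c ≡ true → ⊥
    xor-odd-cycle true  true  _     () _  _
    xor-odd-cycle false false _     () _  _
    xor-odd-cycle true  false true  _  _  ()
    xor-odd-cycle true  false false _  () _
    xor-odd-cycle false true  true  _  () _
    xor-odd-cycle false true  false _  _  ()

  matchingNumber : MatchingNumberAtMost graph m
  matchingNumber M matching =
    subst (length M ≤_) leftCount
      (matchingNumber-≤-cover graph left (λ {a} → xor⇒∨ (left a)) M matching)
    where
    xor⇒∨ : ∀ a {b} → a xor b ≡ true → a ∨ b ≡ true
    xor⇒∨ true  _  = refl
    xor⇒∨ false ab = ab
    leftCount : ∑[ w < m + l ] bit (left w) ≡ m
    leftCount = trans (∑-sides bit) (trans (cong₂ _+_ (*-identityʳ m) (*-zeroʳ l)) (+-identityʳ m))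

theorem2 : (d m : ℕ) → 1 ≤ m → m < d → IsFTriangle d m (d * m)
theorem2 d m _ m<d =
  (graph , (triangleFree , maxDegree (<⇒≤ m<d) , matchingNumber) , numEdges-graph) ,
  λ G (tf , Δ , ν) → numEdges-≤ G d m tf Δ ν m<d
  where open CompleteBipartite m d
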